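{- Let $G$ be a graph and $V\subseteq V(G)$. If every permutation $SV$ of $V$ has a witnessing matching of size at least $k$, then the partial matching width of $V$ is at least $k/2$.
   Context: Given a permutation $SV$ of $V$, split it into a prefix $SV_1$ and the complementary suffix $SV_2$. An edge $\{u,v\}$ of $G$ is supported by $(SV_1,SV_2)$ if either one end lies in $SV_1$ and the other in $SV_2$, or one end lies in $V$ and the other in $V(G)\setminus V$. A matching of $G$ is a witnessing matching for $SV$ if there is a prefix/suffix split $(SV_1,SV_2)$ of $SV$ supporting all its edges. The partial matching width of $V$ is the largest $k$ such that every permutation $SV$ of $V$ has a prefix $SV'$ such that $G$ has a matching of size at least $k$ each of whose edges has one end in $SV'$ and the other in $V(G)\setminus SV'$. -}

module Defs where

open import Data.Nat using (ℕ; _≤_; _*_)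
open import Data.Fin using (Fin)
open import Data.List using (List; []; _∷_; concatMap; take; drop; length)
open import Data.List.Membership.Propositional using (_∈_; _∉_)
open import Data.List.Relation.Unary.All using (All)
open import Data.List.Relation.Unary.Unique.Propositional using (Unique)
open import Data.List.Relation.Binary.Permutation.Propositional using (_↭_)
open import Data.Product using (_×_; _,_; ∃; proj₁; proj₂)
open import Data.Sum using (_⊎_)
open import Relation.Nullary using (¬_)
open import Relation.Binary.PropositionalEquality using (_≡_)

record Graph (n : ℕ) : Set₁ where
  field
    Adj    : Fin n → Fin n → Set
    sym    : ∀ {u v} → Adj u v → Adj v u
    irrefl : ∀ {u} → ¬ Adj u u
open Graph public

Edge : ℕ → Set
Edge n = Fin n × Fin n

endpoints : ∀ {n} → List (Edge n) → List (Fin n)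
endpoints = concatMap (λ e → proj₁ e ∷ proj₂ e ∷ [])

IsMatching : ∀ {n} → Graph n → List (Edge n) → Set
IsMatching G M = All (λ e → Adj G (proj₁ e) (proj₂ e)) M × Unique (endpoints M)

Supported : ∀ {n} → (V SV₁ SV₂ : List (Fin n)) → Edge n → Set
Supported V SV₁ SV₂ (u , v) =
  (u ∈ SV₁ × v ∈ SV₂) ⊎ (u ∈ SV₂ × v ∈ SV₁) ⊎
  (u ∈ V × v ∉ V) ⊎ (u ∉ V × v ∈ V)

WitnessingMatching : ∀ {n} → Graph n → (V SV : List (Fin n)) → List (Edge n) → Set
WitnessingMatching G V SV M =
  IsMatching G M × ∃ λ (i : ℕ) → All (Supported V (take i SV) (drop i SV)) M

Crosses : ∀ {n} → List (Fin n) → Edge n → Set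
Crosses S (u , v) = (u ∈ S × v ∉ S) ⊎ (u ∉ S × v ∈ S)

-- "pmw(V) ≥ k/2": every permutation SV of V has a prefix SV' and a matching of
-- size m with k ≤ 2 m (i.e. m ≥ k/2) all of whose edges cross (SV', V(G) \ SV').
PMWAtLeastHalf : ∀ {n} → Graph n → List (Fin n) → ℕ → Set
PMWAtLeastHalf G V k =
  ∀ (SV : List (Fin _)) → SV ↭ V →
    ∃ λ (i : ℕ) → ∃ λ (M : List (Edge _)) →
      IsMatching G M × All (Crosses (take i SV)) M × k ≤ 2 * length M

module Submission where

-- Fix a permutation SV of V and a witnessing matching M for it,
-- |M| ≥ k, whose edges are all supported by the split (S₁ , S₂) of SV at some
-- position i.  Partition M into the edges crossing the prefix S₁ and the rest.
-- An edge of the first kind of support (one end in S₁, the other in S₂) does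
-- cross S₁, because S₁ and S₂ are disjoint when V has no repeated vertices;
-- so every non-crossing supported edge has one end in V and the other outside
-- V, i.e. it crosses the whole permutation SV, which is itself a prefix of SV.
-- Both parts are submatchings of M and their sizes add up to |M| ≥ k, so one
-- of them has size at least k/2 and crosses a prefix of SV.

open import Defs
open import Data.Nat using (ℕ; _≤_; suc; _+_; _*_)
open import Data.Nat.Properties using (≤-total; ≤-refl; ≤-reflexive; ≤-trans; +-monoˡ-≤; +-monoʳ-≤; m≤m+n; +-suc; module ≤-Reasoning)
open import Data.Fin using (Fin; _≟_)
open import Data.List using (List; []; _∷_; length; take; drop; filter)
open import Data.List.Properties using (take-all)
open import Data.List.Membership.Propositional using (_∈_; _∉_)
import Data.List.Membership.DecPropositional as DecMembership
open import Data.List.Relation.Unary.Any using (here; there)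
open import Data.List.Relation.Unary.All as All using (All; []; _∷_)
open import Data.List.Relation.Unary.All.Properties using (all-filter; filter⁺)
open import Data.List.Relation.Unary.AllPairs using ([]; _∷_)
open import Data.List.Relation.Unary.Unique.Propositional using (Unique)
open import Data.List.Relation.Binary.Sublist.Propositional using (_⊆_; []; _∷_; _∷ʳ_)
open import Data.List.Relation.Binary.Sublist.Propositional.Properties using (All-resp-⊆; Any-resp-⊆; filter-⊆; drop-⊆)
open import Data.List.Relation.Binary.Permutation.Propositional using (_↭_; ↭-sym; ↭⇒↭ₛ)
open import Data.List.Relation.Binary.Permutation.Propositional.Properties using (Any-resp-↭)
import Data.List.Relation.Binary.Permutation.Setoid.Properties as PermutationSetoid
open import Data.Product using (_×_; ∃; _,_)
open import Data.Sum using (_⊎_; inj₁; inj₂; [_,_])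
open import Data.Empty using (⊥-elim)
open import Relation.Nullary using (¬_; ¬?; yes; no)
open import Relation.Nullary.Decidable using (_×-dec_; _⊎-dec_)
open import Relation.Unary using (Pred; Decidable)
open import Relation.Unary.Properties using (∁?)
open import Relation.Binary.PropositionalEquality using (_≡_; refl; trans; cong; subst; setoid) renaming (sym to ≡-sym)

Unique-⊆ : ∀ {a} {A : Set a} {xs ys : List A} → xs ⊆ ys → Unique ys → Unique xs
Unique-⊆ []             []       = []
Unique-⊆ (_ ∷ʳ xs⊆ys)   (_ ∷ u)  = Unique-⊆ xs⊆ys u
Unique-⊆ (refl ∷ xs⊆ys) (y∉ ∷ u) = All-resp-⊆ xs⊆ys y∉ ∷ Unique-⊆ xs⊆ys u

Unique-↭ : ∀ {a} {A : Set a} {xs ys : List A} → xs ↭ ys → Unique xs → Unique ys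
Unique-↭ {A = A} p = PermutationSetoid.Unique-resp-↭ (setoid A) (↭⇒↭ₛ p)

endpoints-⊆ : ∀ {n} {M N : List (Edge n)} → M ⊆ N → endpoints M ⊆ endpoints N
endpoints-⊆ []               = []
endpoints-⊆ ((u , v) ∷ʳ M⊆N) = u ∷ʳ v ∷ʳ endpoints-⊆ M⊆N
endpoints-⊆ (refl ∷ M⊆N)     = refl ∷ refl ∷ endpoints-⊆ M⊆N

submatching : ∀ {n} (G : Graph n) {M N : List (Edge n)} →
  M ⊆ N → IsMatching G N → IsMatching G M
submatching G M⊆N (edges , disjoint) =
  All-resp-⊆ M⊆N edges , Unique-⊆ (endpoints-⊆ M⊆N) disjoint

length-filter-∁ : ∀ {a p} {A : Set a} {P : Pred A p} (P? : Decidable P) (xs : List A) →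
  length (filter P? xs) + length (filter (∁? P?) xs) ≡ length xs
length-filter-∁ P? [] = refl
length-filter-∁ P? (x ∷ xs) with P? x
... | yes _ = cong suc (length-filter-∁ P? xs)
... | no _  = trans (+-suc _ _) (cong suc (length-filter-∁ P? xs))

larger-half : ∀ {k} a b → k ≤ a + b → k ≤ 2 * a ⊎ k ≤ 2 * b
larger-half {k} a b k≤a+b with ≤-total a b
... | inj₁ a≤b = inj₂ (begin
  k           ≤⟨ k≤a+b ⟩
  a + b       ≤⟨ +-monoˡ-≤ b a≤b ⟩
  b + b       ≤⟨ +-monoʳ-≤ b (m≤m+n b 0) ⟩
  2 * b       ∎)
  where open ≤-Reasoning
... | inj₂ b≤a = inj₁ (begin
  k           ≤⟨ k≤a+b ⟩
  a + b       ≤⟨ +-monoʳ-≤ a (≤-trans b≤a (m≤m+n a 0)) ⟩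
  2 * a       ∎)
  where open ≤-Reasoning

drop-∉-take : ∀ {a} {A : Set a} i (xs : List A) {x} →
  Unique xs → x ∈ drop i xs → x ∉ take i xs
drop-∉-take (suc i) (y ∷ ys) (y∉ys ∷ _) x∈drop (here refl) =
  All.lookup y∉ys (Any-resp-⊆ (drop-⊆ i ys) x∈drop) refl
drop-∉-take (suc i) (y ∷ ys) (_ ∷ u) x∈drop (there x∈take) =
  drop-∉-take i ys u x∈drop x∈take

Crosses? : ∀ {n} (S : List (Fin n)) → Decidable (Crosses S)
Crosses? {n} S (u , v) =
  ((u ∈? S) ×-dec ¬? (v ∈? S)) ⊎-dec (¬? (u ∈? S) ×-dec (v ∈? S))
  where open DecMembership (_≟_ {n}) using (_∈?_)

-- The combinatorial heart: if S₁ and S₂ are disjoint and T has the same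
-- vertices as V, then an edge supported by (S₁ , S₂) that does not cross S₁
-- must be of the second kind of support, hence crosses T.
supported-crosses : ∀ {n} {V S₁ S₂ T : List (Fin n)} →
  (∀ {x} → x ∈ S₂ → x ∉ S₁) → (∀ {x} → x ∈ T → x ∈ V) → (∀ {x} → x ∈ V → x ∈ T) →
  ∀ {e} → Supported V S₁ S₂ e → ¬ Crosses S₁ e → Crosses T e
supported-crosses S₂#S₁ T⇒V V⇒T (inj₁ (u∈S₁ , v∈S₂)) ¬cross =
  ⊥-elim (¬cross (inj₁ (u∈S₁ , S₂#S₁ v∈S₂)))
supported-crosses S₂#S₁ T⇒V V⇒T (inj₂ (inj₁ (u∈S₂ , v∈S₁))) ¬cross =
  ⊥-elim (¬cross (inj₂ (S₂#S₁ u∈S₂ , v∈S₁)))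
supported-crosses S₂#S₁ T⇒V V⇒T (inj₂ (inj₂ (inj₁ (u∈V , v∉V)))) _ =
  inj₁ (V⇒T u∈V , λ v∈T → v∉V (T⇒V v∈T))
supported-crosses S₂#S₁ T⇒V V⇒T (inj₂ (inj₂ (inj₂ (u∉V , v∈V)))) _ =
  inj₂ ((λ u∈T → u∉V (T⇒V u∈T)) , V⇒T v∈V)

HalfCrossingPrefix : ∀ {n} → Graph n → List (Fin n) → ℕ → Set
HalfCrossingPrefix {n} G SV k = ∃ λ (j : ℕ) → ∃ λ (M′ : List (Edge n)) →
  IsMatching G M′ × All (Crosses (take j SV)) M′ × k ≤ 2 * length M′

-- One witnessing matching of size at least k for SV yields a matching of
-- size at least k/2 crossing a prefix of SV: either its edges crossing the
-- split prefix, or its remaining edges, which cross the whole of SV.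
half-crossing-prefix : ∀ {n} (G : Graph n) (V SV : List (Fin n)) (k : ℕ) →
  Unique V → SV ↭ V → (M : List (Edge n)) → WitnessingMatching G V SV M → k ≤ length M →
  HalfCrossingPrefix G SV k
half-crossing-prefix G V SV k V-unique SV↭V M (M-matching , i , M-supported) k≤|M| =
  [ via-crossing , via-rest ] (larger-half (length crossing) (length rest) k≤|crossing|+|rest|)
  where
  S₁ : List (Fin _)
  S₁ = take i SV

  crossing rest : List (Edge _)
  crossing = filter (Crosses? S₁) M
  rest = filter (∁? (Crosses? S₁)) M

  suffix-∉-prefix : ∀ {x} → x ∈ drop i SV → x ∉ S₁
  suffix-∉-prefix = drop-∉-take i SV (Unique-↭ (↭-sym SV↭V) V-unique)

  k≤|crossing|+|rest| : k ≤ length crossing + length rest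
  k≤|crossing|+|rest| = ≤-trans k≤|M| (≤-reflexive (≡-sym (length-filter-∁ (Crosses? S₁) M)))

  rest-crosses-SV : All (Crosses SV) rest
  rest-crosses-SV = All.zipWith
    (λ (supported , ¬crossing) →
      supported-crosses suffix-∉-prefix (Any-resp-↭ SV↭V) (Any-resp-↭ (↭-sym SV↭V))
        supported ¬crossing)
    (filter⁺ (∁? (Crosses? S₁)) M-supported , all-filter (∁? (Crosses? S₁)) M)

  via-crossing : k ≤ 2 * length crossing → HalfCrossingPrefix G SV k
  via-crossing k≤2|crossing| =
    i , crossing , submatching G (filter-⊆ _ M) M-matching ,
    all-filter (Crosses? S₁) M , k≤2|crossing|

  via-rest : k ≤ 2 * length rest → HalfCrossingPrefix G SV k
  via-rest k≤2|rest| =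
    length SV , rest , submatching G (filter-⊆ _ M) M-matching ,
    subst (λ T → All (Crosses T) rest) (≡-sym (take-all (length SV) SV ≤-refl)) rest-crosses-SV ,
    k≤2|rest|

proposition3 : ∀ {n} (G : Graph n) (V : List (Fin n)) (k : ℕ) → Unique V →
    (∀ (SV : List (Fin n)) → SV ↭ V →
      ∃ λ (M : List (Edge n)) → WitnessingMatching G V SV M × k ≤ length M) →
    PMWAtLeastHalf G V k
proposition3 G V k V-unique witnessed SV SV↭V =
  let (M , M-witnessing , k≤|M|) = witnessed SV SV↭V
  in half-crossing-prefix G V SV k V-unique SV↭V M M-witnessing k≤|M|
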